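{- Let $H$ be a graph whose odd-girth is $\ell$ (finite). Every vertex $v\in V(H)$ has an even number of neighbours $w$ such that the number of cycles of length $\ell$ in $H$ containing the edge $(v,w)$ is odd.
   Context: Graphs are finite, simple, undirected, loopless. The odd-girth of a graph is the length of its shortest odd-length cycle. -}

module Defs where

open import Data.Nat using (ℕ; zero; suc; _*_; _<_; _≤_)
open import Data.Nat.DivMod using (_%_; _/_; _mod_)
open import Data.Fin using (Fin; toℕ)
open import Data.Fin.Properties using (all?; any?)
import Data.Fin.Properties as FinP
open import Data.Vec using (Vec; []; _∷_; lookup)
open import Data.List using (List; []; _∷_; [_]; map; concatMap; filter; length)
open import Data.List.Base using (allFin)
open import Data.Product using (Σ; _×_; _,_; ∃)
open import Data.Sum using (_⊎_)
open import Relation.Nullary using (¬_; Dec; yes; no)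
open import Relation.Nullary.Decidable using (_×-dec_; _⊎-dec_; _→-dec_)
open import Relation.Binary.PropositionalEquality using (_≡_)
open import Relation.Binary.Definitions using (Decidable; Symmetric)

Odd : ℕ → Set
Odd k = k % 2 ≡ 1

Even : ℕ → Set
Even k = k % 2 ≡ 0

record Graph (n : ℕ) : Set₁ where
  field
    Adj    : Fin n → Fin n → Set
    adj?   : Decidable Adj
    sym    : Symmetric Adj
    irrefl : ∀ {x} → ¬ Adj x x

open Graph public

next : ∀ {k} → Fin k → Fin k
next {suc m} i = suc (toℕ i) mod suc m

IsCycle : ∀ {n} → Graph n → (k : ℕ) → Vec (Fin n) k → Set
IsCycle G k vs =
  (3 ≤ k)
  × (∀ i j → lookup vs i ≡ lookup vs j → i ≡ j)
  × (∀ i → Adj G (lookup vs i) (lookup vs (next i)))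

isCycle? : ∀ {n} (G : Graph n) (k : ℕ) (vs : Vec (Fin n) k) → Dec (IsCycle G k vs)
isCycle? G k vs =
  (3 Data.Nat.≤? k)
  ×-dec all? (λ i → all? (λ j → (lookup vs i FinP.≟ lookup vs j) →-dec (i FinP.≟ j)))
  ×-dec all? (λ i → adj? G (lookup vs i) (lookup vs (next i)))

HasCycle : ∀ {n} → Graph n → ℕ → Set
HasCycle {n} G k = Σ (Vec (Fin n) k) (IsCycle G k)

OddGirth : ∀ {n} → Graph n → ℕ → Set
OddGirth G ℓ = Odd ℓ × HasCycle G ℓ × (∀ k → Odd k → k < ℓ → ¬ HasCycle G k)

UsesEdge : ∀ {n k} → Vec (Fin n) k → Fin n → Fin n → Set
UsesEdge vs v w =
  ∃ λ i → (lookup vs i ≡ v × lookup vs (next i) ≡ w)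
        ⊎ (lookup vs i ≡ w × lookup vs (next i) ≡ v)

usesEdge? : ∀ {n k} (vs : Vec (Fin n) k) (v w : Fin n) → Dec (UsesEdge vs v w)
usesEdge? vs v w = any? (λ i →
  ((lookup vs i FinP.≟ v) ×-dec (lookup vs (next i) FinP.≟ w))
  ⊎-dec ((lookup vs i FinP.≟ w) ×-dec (lookup vs (next i) FinP.≟ v)))

allVecs : (n k : ℕ) → List (Vec (Fin n) k)
allVecs n zero = [ [] ]
allVecs n (suc k) = concatMap (λ x → map (x ∷_) (allVecs n k)) (allFin n)

cycleSeqsThrough : ∀ {n} → Graph n → (k : ℕ) → Fin n → Fin n → ℕ
cycleSeqsThrough {n} G k v w =
  length (filter (λ vs → isCycle? G k vs ×-dec usesEdge? vs v w) (allVecs n k))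

-- Number of cycles (as subgraphs) of length k ≥ 3 containing the edge {v,w}:
-- each such cycle is represented by exactly 2k cyclic sequences
-- (k rotations × 2 orientations).
cyclesThrough : ∀ {n} → Graph n → (k : ℕ) → Fin n → Fin n → ℕ
cyclesThrough G zero v w = 0
cyclesThrough G (suc k) v w = cycleSeqsThrough G (suc k) v w / (2 * suc k)

oddNeighbours : ∀ {n} → Graph n → ℕ → Fin n → ℕ
oddNeighbours {n} G ℓ v =
  length (filter (λ w → adj? G v w ×-dec (cyclesThrough G ℓ v w % 2 Data.Nat.≟ 1)) (allFin n))

-- Every k-cycle through v contains exactly two edges at v, so summing over the neighbours w
-- of v the number c(v,w) of k-cycles through vw counts each k-cycle through v twice; the sum
-- is even, hence so is the number of w with c(v,w) odd.  Cycles are given as vertex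
-- sequences, and the dihedral group of order 2k acts freely on the sequences of a k-cycle:
-- the sequences through the edge {v,w} correspond bijectively to pairs (symmetry, sequence
-- starting with v, w), so c(v,w) is the number of cycle sequences starting with v, w.
-- Summing over w counts the cycle sequences starting at v, and these are paired off by the
-- reflection that fixes the starting position.
module Submission where

open import Defs hiding (sym)
open import Data.Bool using (Bool; true; false)
open import Data.Bool.Properties using (T-irrelevant)
open import Data.Empty using (⊥-elim)
open import Data.Fin using (Fin; zero; suc; toℕ; fromℕ; inject₁)
import Data.Fin as Fin
import Data.Fin.Properties as Finₚ
open import Data.Fin.Permutation
  using (Permutation′; permutation; _⟨$⟩ʳ_; _⟨$⟩ˡ_; inverseˡ; inverseʳ; _∘ₚ_; flip; ↔⇒≡)
open import Data.Fin.Relation.Unary.Top using (view; ‵fromℕ; ‵inject₁)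
open import Data.List using (List; []; _∷_; [_]; _++_; map; concatMap; filter; length; tabulate; allFin)
open import Data.List.Properties
  using (length-++; filter-++; map-tabulate; map-cong; filter-≐; filter-accept; filter-reject)
open import Data.Nat using (ℕ; zero; suc; _+_; _*_; _%_; _/_; _≟_; _≤_; _<_; s≤s; NonZero)
open import Data.Nat.DivMod using (%-distribˡ-+; m%n<n; m*n%n≡0; m*n/n≡m; m<n⇒m%n≡m; n%n≡0)
open import Data.Nat.GeneralisedArithmetic using (fold)
open import Data.Nat.ListAction using (sum)
open import Data.Nat.Properties using (<-trans; n<1+n; 1+n≢0; *-comm)
open import Data.Product using (Σ; _×_; _,_; proj₁; proj₂)
open import Data.Product.Function.Dependent.Propositional using (Σ-↔)
open import Data.Product.Function.NonDependent.Propositional using (_×-↔_)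
open import Data.Sum using (_⊎_; inj₁; inj₂; [_,_]′)
open import Data.Sum.Function.Propositional using (_⊎-↔_)
open import Data.Vec using (Vec; []; _∷_; lookup)
import Data.Vec as Vec
open import Data.Vec.Properties using (lookup∘tabulate; tabulate-cong; tabulate∘lookup)
open import Function using (_∘_; id; _↔_; mk↔ₛ′; Inverse)
open import Function.Properties.Inverse using (↔-refl; ↔-trans)
open import Function.Related.Propositional using (module EquationalReasoning)
open import Level using (0ℓ)
open import Relation.Binary.Definitions using (tri<; tri≈; tri>)
open import Relation.Binary.PropositionalEquality
  using (_≡_; _≢_; refl; sym; trans; cong; cong₂; subst; subst₂; module ≡-Reasoning)
open import Relation.Nullary using (Dec; yes; no; ¬_)
open import Relation.Nullary.Decidable using (True; toWitness; fromWitness; _×-dec_)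
open import Relation.Unary using (Pred; Decidable; _≐_)

-- Membership is recorded as True (P? x) rather than P x: proofs of IsCycle contain functions
-- and are not unique, whereas True (P? x) is proof-irrelevant.
⟨_⟩ : {A : Set} {P : Pred A 0ℓ} → Decidable P → Set
⟨_⟩ {A} P? = Σ A (λ x → True (P? x))

module _ {A : Set} {P : Pred A 0ℓ} (P? : Decidable P) where

  ⟨⟩-≡ : {x y : A} {s : True (P? x)} {t : True (P? y)} → x ≡ y → _≡_ {A = ⟨ P? ⟩} (x , s) (y , t)
  ⟨⟩-≡ {x} {s = s} {t} refl = cong (x ,_) (T-irrelevant s t)

  length-filter-map : {B : Set} (f : B → A) (xs : List B) →
                      length (filter P? (map f xs)) ≡ length (filter (P? ∘ f) xs)
  length-filter-map f [] = refl
  length-filter-map f (x ∷ xs) with P? (f x)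
  ... | yes _ = cong suc (length-filter-map f xs)
  ... | no _  = length-filter-map f xs

  length-filter-concatMap : {B : Set} (f : B → List A) (xs : List B) →
                            length (filter P? (concatMap f xs)) ≡ sum (map (length ∘ filter P? ∘ f) xs)
  length-filter-concatMap f [] = refl
  length-filter-concatMap f (x ∷ xs) = begin
    length (filter P? (f x ++ concatMap f xs))                 ≡⟨ cong length (filter-++ P? (f x) _) ⟩
    length (filter P? (f x) ++ filter P? (concatMap f xs))     ≡⟨ length-++ (filter P? (f x)) ⟩
    length (filter P? (f x)) + length (filter P? (concatMap f xs))
      ≡⟨ cong (length (filter P? (f x)) +_) (length-filter-concatMap f xs) ⟩
    length (filter P? (f x)) + sum (map (length ∘ filter P? ∘ f) xs) ∎
    where open ≡-Reasoning

  Fin-length-filter-singleton↔True : (x : A) → Fin (length (filter P? [ x ])) ↔ True (P? x)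
  Fin-length-filter-singleton↔True x with P? x
  ... | yes _ = Finₚ.1↔⊤
  ... | no _  = Finₚ.0↔⊥

Σ-Fin-suc↔ : ∀ {n} (B : Fin (suc n) → Set) → (B zero ⊎ Σ (Fin n) (B ∘ suc)) ↔ Σ (Fin (suc n)) B
Σ-Fin-suc↔ B = mk↔ₛ′
  (λ { (inj₁ b) → zero , b ; (inj₂ (i , b)) → suc i , b })
  (λ { (zero , b) → inj₁ b ; (suc i , b) → inj₂ (i , b) })
  (λ { (zero , b) → refl ; (suc i , b) → refl })
  (λ { (inj₁ b) → refl ; (inj₂ (i , b)) → refl })

Fin-sum-tabulate↔Σ : ∀ {n} (f : Fin n → ℕ) → Fin (sum (tabulate f)) ↔ Σ (Fin n) (Fin ∘ f)
Fin-sum-tabulate↔Σ {zero}  f = mk↔ₛ′ (λ ()) (λ ()) (λ ()) (λ ())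
Fin-sum-tabulate↔Σ {suc n} f =
  ↔-trans Finₚ.+↔⊎ (↔-trans (↔-refl ⊎-↔ Fin-sum-tabulate↔Σ (f ∘ suc)) (Σ-Fin-suc↔ (Fin ∘ f)))

Fin-length-filter-allVecs↔⟨⟩ : ∀ {n} k {P : Pred (Vec (Fin n) k) 0ℓ} (P? : Decidable P) →
                               Fin (length (filter P? (allVecs n k))) ↔ ⟨ P? ⟩
Fin-length-filter-allVecs↔⟨⟩ zero P? = ↔-trans (Fin-length-filter-singleton↔True P? [])
  (mk↔ₛ′ ([] ,_) (λ { ([] , t) → t }) (λ { ([] , t) → refl }) (λ _ → refl))
Fin-length-filter-allVecs↔⟨⟩ {n} (suc k) P? = subst (λ c → Fin c ↔ ⟨ P? ⟩) (sym count-by-head) (begin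
  Fin (sum (tabulate countWithHead))       ↔⟨ Fin-sum-tabulate↔Σ countWithHead ⟩
  Σ (Fin n) (Fin ∘ countWithHead)          ↔⟨ Σ-↔ ↔-refl (λ {x} → count-tail x) ⟩
  Σ (Fin n) (λ x → ⟨ P? ∘ (x ∷_) ⟩)        ↔⟨ cons↔ ⟩
  ⟨ P? ⟩                                   ∎)
  where
  open EquationalReasoning
  count-tail : ∀ x → Fin (length (filter (P? ∘ (x ∷_)) (allVecs n k))) ↔ ⟨ P? ∘ (x ∷_) ⟩
  count-tail x = Fin-length-filter-allVecs↔⟨⟩ k (P? ∘ (x ∷_))
  countWithHead : Fin n → ℕ
  countWithHead x = length (filter (P? ∘ (x ∷_)) (allVecs n k))
  count-by-head : length (filter P? (allVecs n (suc k))) ≡ sum (tabulate countWithHead)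
  count-by-head = trans (length-filter-concatMap P? _ (allFin n))
    (cong sum (trans (map-cong (λ x → length-filter-map P? (x ∷_) (allVecs n k)) (allFin n))
                     (map-tabulate id countWithHead)))
  cons↔ : Σ (Fin n) (λ x → ⟨ P? ∘ (x ∷_) ⟩) ↔ ⟨ P? ⟩
  cons↔ = mk↔ₛ′ (λ { (x , xs , t) → x ∷ xs , t }) (λ { (x ∷ xs , t) → x , xs , t })
    (λ { (x ∷ xs , t) → refl }) (λ { (x , xs , t) → refl })

module _ {A : Set} {P R : Pred A 0ℓ} (P? : Decidable P) (R? : Decidable R) (f : A → A)
         (f-involutive : ∀ x → f (f x) ≡ x) (f-preserves : ∀ x → P x → P (f x))
         (R-or : ∀ x → P x → R x ⊎ R (f x)) (R-not-both : ∀ x → R x → ¬ R (f x)) where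

  ⟨⟩↔Bool×⟨∩⟩ : ⟨ P? ⟩ ↔ (Bool × ⟨ (λ x → P? x ×-dec R? x) ⟩)
  ⟨⟩↔Bool×⟨∩⟩ = mk↔ₛ′ to from to∘from from∘to
    where
    P∩R? = λ x → P? x ×-dec R? x

    classify : ∀ x → True (P? x) → Dec (R x) → Bool × ⟨ P∩R? ⟩
    classify x t (yes r) = true , x , fromWitness (toWitness t , r)
    classify x t (no ¬r) = false , f x ,
      fromWitness (f-preserves x (toWitness t) , [ ⊥-elim ∘ ¬r , id ]′ (R-or x (toWitness t)))

    to : ⟨ P? ⟩ → Bool × ⟨ P∩R? ⟩
    to (x , t) = classify x t (R? x)

    from : Bool × ⟨ P∩R? ⟩ → ⟨ P? ⟩
    from (true  , x , t) = x , fromWitness (proj₁ (toWitness t))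
    from (false , x , t) = f x , fromWitness (f-preserves x (proj₁ (toWitness t)))

    to∘from : ∀ y → to (from y) ≡ y
    to∘from (true , x , t) = kept (R? x)
      where
      kept : ∀ {s} d → classify x s d ≡ (true , x , t)
      kept (yes _) = cong (true ,_) (⟨⟩-≡ P∩R? refl)
      kept (no ¬r) = ⊥-elim (¬r (proj₂ (toWitness t)))
    to∘from (false , x , t) = flipped (R? (f x))
      where
      flipped : ∀ {s} d → classify (f x) s d ≡ (false , x , t)
      flipped (yes r) = ⊥-elim (R-not-both x (proj₂ (toWitness t)) r)
      flipped (no _)  = cong (false ,_) (⟨⟩-≡ P∩R? (f-involutive x))

    from∘to : ∀ x → from (to x) ≡ x
    from∘to (x , t) = restored (R? x)
      where
      restored : ∀ d → from (classify x t d) ≡ (x , t)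
      restored (yes _) = ⟨⟩-≡ P? refl
      restored (no _)  = ⟨⟩-≡ P? (f-involutive x)

+-cong-% : ∀ {a b c d} k .{{_ : NonZero k}} → a % k ≡ b % k → c % k ≡ d % k → (a + c) % k ≡ (b + d) % k
+-cong-% {a} {b} {c} {d} k a≡b c≡d = begin
  (a + c) % k           ≡⟨ %-distribˡ-+ a c k ⟩
  (a % k + c % k) % k   ≡⟨ cong₂ (λ x y → (x + y) % k) a≡b c≡d ⟩
  (b % k + d % k) % k   ≡⟨ %-distribˡ-+ b d k ⟨
  (b + d) % k           ∎
  where open ≡-Reasoning

¬Odd⇒Even : ∀ a → ¬ Odd a → Even a
¬Odd⇒Even a ¬odd with a % 2 | m%n<n a 2
... | 0           | _ = refl
... | 1           | _ = ⊥-elim (¬odd refl)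
... | suc (suc _) | s≤s (s≤s ())

module _ {X : Set} (c : X → ℕ) where

  odd? : Decidable (λ x → Odd (c x))
  odd? x = c x % 2 ≟ 1

  length-filter-Odd≡sum-mod-2 : ∀ xs → length (filter odd? xs) % 2 ≡ sum (map c xs) % 2
  length-filter-Odd≡sum-mod-2 [] = refl
  length-filter-Odd≡sum-mod-2 (x ∷ xs) with odd? x
  ... | yes odd = begin
    length (filter odd? (x ∷ xs)) % 2   ≡⟨ cong (λ ys → length ys % 2) (filter-accept odd? odd) ⟩
    (1 + length (filter odd? xs)) % 2   ≡⟨ +-cong-% {1} {c x} {length (filter odd? xs)} {sum (map c xs)} 2
                                             (sym odd) (length-filter-Odd≡sum-mod-2 xs) ⟩
    (c x + sum (map c xs)) % 2          ∎
    where open ≡-Reasoning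
  ... | no ¬odd = begin
    length (filter odd? (x ∷ xs)) % 2   ≡⟨ cong (λ ys → length ys % 2) (filter-reject odd? ¬odd) ⟩
    (0 + length (filter odd? xs)) % 2   ≡⟨ +-cong-% {0} {c x} {length (filter odd? xs)} {sum (map c xs)} 2
                                             (sym (¬Odd⇒Even (c x) ¬odd)) (length-filter-Odd≡sum-mod-2 xs) ⟩
    (c x + sum (map c xs)) % 2          ∎
    where open ≡-Reasoning

⟨$⟩ʳ-injective : ∀ {n} (π : Permutation′ n) {i j} → π ⟨$⟩ʳ i ≡ π ⟨$⟩ʳ j → i ≡ j
⟨$⟩ʳ-injective π e = trans (sym (inverseˡ π)) (trans (cong (π ⟨$⟩ˡ_) e) (inverseˡ π))

module _ {A : Set} where

  fold-commute : (f g : A → A) → (∀ x → f (g x) ≡ g (f x)) →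
                 ∀ x t → fold (g x) f t ≡ g (fold x f t)
  fold-commute f g f∘g≗g∘f x zero    = refl
  fold-commute f g f∘g≗g∘f x (suc t) = trans (cong f (fold-commute f g f∘g≗g∘f x t)) (f∘g≗g∘f _)

  fold-suc : (f : A → A) (x : A) (t : ℕ) → fold x f (suc t) ≡ fold (f x) f t
  fold-suc f x t = sym (fold-commute f f (λ _ → refl) x t)

  fold-inverse : (f g : A → A) → (∀ x → g (f x) ≡ x) → ∀ x t → fold (fold x f t) g t ≡ x
  fold-inverse f g g∘f≗id x zero    = refl
  fold-inverse f g g∘f≗id x (suc t) = begin
    fold (f (fold x f t)) g (suc t)   ≡⟨ fold-suc g _ t ⟩
    fold (g (f (fold x f t))) g t     ≡⟨ cong (λ y → fold y g t) (g∘f≗id _) ⟩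
    fold (fold x f t) g t             ≡⟨ fold-inverse f g g∘f≗id x t ⟩
    x                                 ∎
    where open ≡-Reasoning

module _ {m : ℕ} where

  prev : Fin (suc m) → Fin (suc m)
  prev zero    = fromℕ m
  prev (suc i) = inject₁ i

  toℕ-next : (i : Fin (suc m)) → toℕ (next i) ≡ suc (toℕ i) % suc m
  toℕ-next i = Finₚ.toℕ-fromℕ< _

  next-inject₁ : (i : Fin m) → next (inject₁ i) ≡ suc i
  next-inject₁ i = Finₚ.toℕ-injective (begin
    toℕ (next (inject₁ i))          ≡⟨ toℕ-next (inject₁ i) ⟩
    suc (toℕ (inject₁ i)) % suc m   ≡⟨ cong (λ k → suc k % suc m) (Finₚ.toℕ-inject₁ i) ⟩
    suc (toℕ i) % suc m             ≡⟨ m<n⇒m%n≡m (s≤s (Finₚ.toℕ<n i)) ⟩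
    suc (toℕ i)                     ∎)
    where open ≡-Reasoning

  next-fromℕ : next (fromℕ m) ≡ zero
  next-fromℕ = Finₚ.toℕ-injective (begin
    toℕ (next (fromℕ m))          ≡⟨ toℕ-next (fromℕ m) ⟩
    suc (toℕ (fromℕ m)) % suc m   ≡⟨ cong (λ k → suc k % suc m) (Finₚ.toℕ-fromℕ m) ⟩
    suc m % suc m                 ≡⟨ n%n≡0 (suc m) ⟩
    0                             ∎)
    where open ≡-Reasoning

  next-prev : ∀ i → next (prev i) ≡ i
  next-prev zero    = next-fromℕ
  next-prev (suc i) = next-inject₁ i

  prev-next : ∀ i → prev (next i) ≡ i
  prev-next i with view i
  ... | ‵fromℕ     = cong prev next-fromℕ
  ... | ‵inject₁ j = cong prev (next-inject₁ j)

  toℕ-fold-next : ∀ t → t < suc m → toℕ (fold zero next t) ≡ t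
  toℕ-fold-next zero    _   = refl
  toℕ-fold-next (suc t) t<K = begin
    toℕ (next (fold zero next t))          ≡⟨ toℕ-next _ ⟩
    suc (toℕ (fold zero next t)) % suc m   ≡⟨ cong (λ k → suc k % suc m) ih ⟩
    suc t % suc m                          ≡⟨ m<n⇒m%n≡m t<K ⟩
    suc t                                  ∎
    where
    open ≡-Reasoning
    ih = toℕ-fold-next t (<-trans (n<1+n t) t<K)

  fold-next-toℕ : ∀ i → fold zero next (toℕ i) ≡ i
  fold-next-toℕ i = Finₚ.toℕ-injective (toℕ-fold-next (toℕ i) (Finₚ.toℕ<n i))

  fold-next-period : fold zero next (suc m) ≡ zero
  fold-next-period = begin
    next (fold zero next m)                 ≡⟨ cong (next ∘ fold zero next) (Finₚ.toℕ-fromℕ m) ⟨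
    next (fold zero next (toℕ (fromℕ m)))   ≡⟨ cong next (fold-next-toℕ (fromℕ m)) ⟩
    next (fromℕ m)                          ≡⟨ next-fromℕ ⟩
    zero                                    ∎
    where open ≡-Reasoning

  fold-prev-period : fold zero prev (suc m) ≡ zero
  fold-prev-period = begin
    fold zero prev (suc m)                       ≡⟨ cong (λ i → fold i prev (suc m)) fold-next-period ⟨
    fold (fold zero next (suc m)) prev (suc m)   ≡⟨ fold-inverse next prev prev-next zero (suc m) ⟩
    zero                                         ∎
    where open ≡-Reasoning

  rotation : Fin (suc m) → Permutation′ (suc m)
  rotation p = permutation (λ j → fold j next (toℕ p)) (λ j → fold j prev (toℕ p))
    (λ j → fold-inverse prev next next-prev j (toℕ p)) (λ j → fold-inverse next prev prev-next j (toℕ p))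

  rotation-zero : ∀ p → rotation p ⟨$⟩ʳ zero ≡ p
  rotation-zero = fold-next-toℕ

  rotation-next : ∀ p j → rotation p ⟨$⟩ʳ next j ≡ next (rotation p ⟨$⟩ʳ j)
  rotation-next p j = fold-commute next next (λ _ → refl) j (toℕ p)

  rotation-prev : ∀ p j → rotation p ⟨$⟩ʳ prev j ≡ prev (rotation p ⟨$⟩ʳ j)
  rotation-prev p j = fold-commute next prev (λ x → trans (next-prev x) (sym (prev-next x))) j (toℕ p)

  reflect : Fin (suc m) → Fin (suc m)
  reflect j = fold zero prev (toℕ j)

  reflect-next : ∀ j → reflect (next j) ≡ prev (reflect j)
  reflect-next j with view j
  ... | ‵fromℕ = begin
    reflect (next (fromℕ m))   ≡⟨ cong reflect next-fromℕ ⟩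
    zero                       ≡⟨ fold-prev-period ⟨
    fold zero prev (suc m)     ≡⟨ cong (λ t → fold zero prev (suc t)) (Finₚ.toℕ-fromℕ m) ⟨
    prev (reflect (fromℕ m))   ∎
    where open ≡-Reasoning
  ... | ‵inject₁ i = begin
    reflect (next (inject₁ i))   ≡⟨ cong reflect (next-inject₁ i) ⟩
    reflect (suc i)              ≡⟨ cong (λ t → fold zero prev (suc t)) (Finₚ.toℕ-inject₁ i) ⟨
    prev (reflect (inject₁ i))   ∎
    where open ≡-Reasoning

  reflect-prev : ∀ j → reflect (prev j) ≡ next (reflect j)
  reflect-prev j = begin
    reflect (prev j)                 ≡⟨ next-prev _ ⟨
    next (prev (reflect (prev j)))   ≡⟨ cong next (reflect-next (prev j)) ⟨
    next (reflect (next (prev j)))   ≡⟨ cong (next ∘ reflect) (next-prev j) ⟩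
    next (reflect j)                 ∎
    where open ≡-Reasoning

  reflect-involutive : ∀ j → reflect (reflect j) ≡ j
  reflect-involutive j = trans (reflect-fold-prev (toℕ j)) (fold-next-toℕ j)
    where
    reflect-fold-prev : ∀ t → reflect (fold zero prev t) ≡ fold zero next t
    reflect-fold-prev zero    = refl
    reflect-fold-prev (suc t) = trans (reflect-prev (fold zero prev t)) (cong next (reflect-fold-prev t))

  reflection : Permutation′ (suc m)
  reflection = permutation reflect reflect reflect-involutive reflect-involutive

  step : Bool → Fin (suc m) → Fin (suc m)
  step true  = next
  step false = prev

  IsSymmetry : Bool → Permutation′ (suc m) → Set
  IsSymmetry b σ = ∀ j → σ ⟨$⟩ʳ next j ≡ step b (σ ⟨$⟩ʳ j)

  next∘σ≡σ∘step : ∀ b σ → IsSymmetry b σ → ∀ j → next (σ ⟨$⟩ʳ j) ≡ σ ⟨$⟩ʳ step b j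
  next∘σ≡σ∘step true  σ σ-sym j = sym (σ-sym j)
  next∘σ≡σ∘step false σ σ-sym j = begin
    next (σ ⟨$⟩ʳ j)               ≡⟨ cong (λ i → next (σ ⟨$⟩ʳ i)) (next-prev j) ⟨
    next (σ ⟨$⟩ʳ next (prev j))   ≡⟨ cong next (σ-sym (prev j)) ⟩
    next (prev (σ ⟨$⟩ʳ prev j))   ≡⟨ next-prev _ ⟩
    σ ⟨$⟩ʳ prev j                 ∎
    where open ≡-Reasoning

  IsSymmetry-flip : ∀ b σ → IsSymmetry b σ → IsSymmetry b (flip σ)
  IsSymmetry-flip b σ σ-sym j = begin
    σ ⟨$⟩ˡ next j                     ≡⟨ cong (λ i → σ ⟨$⟩ˡ next i) (inverseʳ σ) ⟨
    σ ⟨$⟩ˡ next (σ ⟨$⟩ʳ (σ ⟨$⟩ˡ j))     ≡⟨ cong (σ ⟨$⟩ˡ_) (next∘σ≡σ∘step b σ σ-sym _) ⟩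
    σ ⟨$⟩ˡ (σ ⟨$⟩ʳ step b (σ ⟨$⟩ˡ j))   ≡⟨ inverseˡ σ ⟩
    step b (σ ⟨$⟩ˡ j)                 ∎
    where open ≡-Reasoning

  dihedral : Bool × Fin (suc m) → Permutation′ (suc m)
  dihedral (true  , p) = rotation p
  dihedral (false , p) = reflection ∘ₚ rotation p

  dihedral-zero : ∀ g → dihedral g ⟨$⟩ʳ zero ≡ proj₂ g
  dihedral-zero (true  , p) = rotation-zero p
  dihedral-zero (false , p) = rotation-zero p

  dihedral-next : ∀ g → IsSymmetry (proj₁ g) (dihedral g)
  dihedral-next (true  , p) j = rotation-next p j
  dihedral-next (false , p) j = trans (cong (rotation p ⟨$⟩ʳ_) (reflect-next j)) (rotation-prev p (reflect j))

  dihedral-one : ∀ b p → dihedral (b , p) ⟨$⟩ʳ next zero ≡ step b p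
  dihedral-one b p = trans (dihedral-next (b , p) zero) (cong (step b) (dihedral-zero (b , p)))

  next≢prev : 3 ≤ suc m → ∀ p → next p ≢ prev p
  next≢prev 3≤K p next≡prev = 1+n≢0 (trans (sym (toℕ-fold-next 2 3≤K)) (cong toℕ next²-zero))
    where
    open ≡-Reasoning
    next²-zero : next (next zero) ≡ zero
    next²-zero = ⟨$⟩ʳ-injective (rotation p) (begin
      rotation p ⟨$⟩ʳ next (next zero)     ≡⟨ rotation-next p _ ⟩
      next (rotation p ⟨$⟩ʳ next zero)     ≡⟨ cong next (rotation-next p zero) ⟩
      next (next (rotation p ⟨$⟩ʳ zero))   ≡⟨ cong (next ∘ next) (rotation-zero p) ⟩
      next (next p)                        ≡⟨ cong next next≡prev ⟩
      next (prev p)                        ≡⟨ next-prev p ⟩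
      p                                    ≡⟨ rotation-zero p ⟨
      rotation p ⟨$⟩ʳ zero                 ∎)

  dihedral-unique : 3 ≤ suc m → ∀ g h →
                    dihedral g ⟨$⟩ʳ zero ≡ dihedral h ⟨$⟩ʳ zero →
                    dihedral g ⟨$⟩ʳ next zero ≡ dihedral h ⟨$⟩ʳ next zero → g ≡ h
  dihedral-unique 3≤K (b , p) (c , q) at-zero at-one
    with refl ← trans (sym (dihedral-zero (b , p))) (trans at-zero (dihedral-zero (c , q)))
    = cong (_, p) (step-injective b c (trans (sym (dihedral-one b p)) (trans at-one (dihedral-one c p))))
    where
    step-injective : ∀ b c → step b p ≡ step c p → b ≡ c
    step-injective true  true  _ = refl
    step-injective true  false e = ⊥-elim (next≢prev 3≤K p e)
    step-injective false true  e = ⊥-elim (next≢prev 3≤K p (sym e))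
    step-injective false false _ = refl

reindex : {A : Set} {k : ℕ} → (Fin k → Fin k) → Vec A k → Vec A k
reindex f vs = Vec.tabulate (lookup vs ∘ f)

lookup-reindex : {A : Set} {k : ℕ} (f : Fin k → Fin k) (vs : Vec A k) (j : Fin k) →
                 lookup (reindex f vs) j ≡ lookup vs (f j)
lookup-reindex f vs = lookup∘tabulate (lookup vs ∘ f)

reindex-cancel : {A : Set} {k : ℕ} (f g : Fin k → Fin k) → (∀ j → g (f j) ≡ j) →
                 (vs : Vec A k) → reindex f (reindex g vs) ≡ vs
reindex-cancel f g g∘f≗id vs = trans
  (tabulate-cong (λ j → trans (lookup-reindex g vs (f j)) (cong (lookup vs) (g∘f≗id j))))
  (tabulate∘lookup vs)

module _ {n : ℕ} (G : Graph n) {m : ℕ} where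

  cycle-step : ∀ {vs} → IsCycle G (suc m) vs → ∀ b j → Adj G (lookup vs j) (lookup vs (step b j))
  cycle-step (_ , _ , adj) true  j = adj j
  cycle-step {vs} (_ , _ , adj) false j =
    Graph.sym G (subst (Adj G (lookup vs (prev j)) ∘ lookup vs) (next-prev j) (adj (prev j)))

  IsCycle-reindex : ∀ b σ → IsSymmetry b σ → ∀ vs →
                    IsCycle G (suc m) vs → IsCycle G (suc m) (reindex (σ ⟨$⟩ʳ_) vs)
  IsCycle-reindex b σ σ-sym vs c@(3≤K , injective , _) = 3≤K , injective′ , adjacent
    where
    ws = reindex (σ ⟨$⟩ʳ_) vs
    ws≡vs∘σ : ∀ i → lookup ws i ≡ lookup vs (σ ⟨$⟩ʳ i)
    ws≡vs∘σ = lookup-reindex (σ ⟨$⟩ʳ_) vs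
    injective′ : ∀ i j → lookup ws i ≡ lookup ws j → i ≡ j
    injective′ i j e =
      ⟨$⟩ʳ-injective σ (injective _ _ (trans (sym (ws≡vs∘σ i)) (trans e (ws≡vs∘σ j))))
    adjacent : ∀ i → Adj G (lookup ws i) (lookup ws (next i))
    adjacent i = subst₂ (Adj G) (sym (ws≡vs∘σ i))
      (sym (trans (ws≡vs∘σ (next i)) (cong (lookup vs) (σ-sym i))))
      (cycle-step {vs} c b (σ ⟨$⟩ʳ i))

module RootedCycles {n : ℕ} (G : Graph n) {m : ℕ} (3≤K : 3 ≤ suc m) (v : Fin n) where

  Symmetry : Set
  Symmetry = Bool × Fin (suc m)

  StartsWith : Fin n → Vec (Fin n) (suc m) → Set
  StartsWith w us = lookup us zero ≡ v × lookup us (next zero) ≡ w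

  EdgeAt : Vec (Fin n) (suc m) → Symmetry → Fin n → Set
  EdgeAt vs g w = lookup vs (dihedral g ⟨$⟩ʳ zero) ≡ v × lookup vs (dihedral g ⟨$⟩ʳ next zero) ≡ w

  through? : ∀ w → Decidable (λ vs → IsCycle G (suc m) vs × UsesEdge vs v w)
  through? w vs = isCycle? G (suc m) vs ×-dec usesEdge? vs v w

  rooted? : ∀ w → Decidable (λ us → IsCycle G (suc m) us × StartsWith w us)
  rooted? w us =
    isCycle? G (suc m) us ×-dec ((lookup us zero Finₚ.≟ v) ×-dec (lookup us (next zero) Finₚ.≟ w))

  cycleAt? : Decidable (λ us → IsCycle G (suc m) us × lookup us zero ≡ v)
  cycleAt? us = isCycle? G (suc m) us ×-dec (lookup us zero Finₚ.≟ v)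

  ordered? : Decidable (λ (us : Vec (Fin n) (suc m)) → lookup us (next zero) Fin.< lookup us (prev zero))
  ordered? us = lookup us (next zero) Finₚ.<? lookup us (prev zero)

  module _ (vs : Vec (Fin n) (suc m)) (w : Fin n) where

    edgeAt⁺ : ∀ b p → lookup vs p ≡ v → lookup vs (step b p) ≡ w → EdgeAt vs (b , p) w
    edgeAt⁺ b p vₚ≡v vₛ≡w = trans (cong (lookup vs) (dihedral-zero (b , p))) vₚ≡v ,
                            trans (cong (lookup vs) (dihedral-one b p)) vₛ≡w

    edgeAt⁻ : ∀ b p → EdgeAt vs (b , p) w → lookup vs p ≡ v × lookup vs (step b p) ≡ w
    edgeAt⁻ b p (σ₀≡v , σ₁≡w) = trans (cong (lookup vs) (sym (dihedral-zero (b , p)))) σ₀≡v ,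
                                trans (cong (lookup vs) (sym (dihedral-one b p))) σ₁≡w

    orientation : UsesEdge vs v w → Symmetry
    orientation (i , inj₁ _) = true , i
    orientation (i , inj₂ _) = false , next i

    orientation-edgeAt : (u : UsesEdge vs v w) → EdgeAt vs (orientation u) w
    orientation-edgeAt (i , inj₁ (vᵢ≡v , vᵢ₊₁≡w)) = edgeAt⁺ true i vᵢ≡v vᵢ₊₁≡w
    orientation-edgeAt (i , inj₂ (vᵢ≡w , vᵢ₊₁≡v)) =
      edgeAt⁺ false (next i) vᵢ₊₁≡v (trans (cong (lookup vs) (prev-next i)) vᵢ≡w)

    edgeAt⇒UsesEdge : ∀ g → EdgeAt vs g w → UsesEdge vs v w
    edgeAt⇒UsesEdge (true  , p) at = p , inj₁ (edgeAt⁻ true p at)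
    edgeAt⇒UsesEdge (false , p) at with edgeAt⁻ false p at
    ... | vₚ≡v , vₚ₋₁≡w = prev p , inj₂ (vₚ₋₁≡w , trans (cong (lookup vs) (next-prev p)) vₚ≡v)

    edgeAt-unique : IsCycle G (suc m) vs → ∀ g h → EdgeAt vs g w → EdgeAt vs h w → g ≡ h
    edgeAt-unique (_ , injective , _) g h (g₀ , g₁) (h₀ , h₁) =
      dihedral-unique 3≤K g h (injective _ _ (trans g₀ (sym h₀))) (injective _ _ (trans g₁ (sym h₁)))

    startsWith-reindex : ∀ g → EdgeAt vs g w → StartsWith w (reindex (dihedral g ⟨$⟩ʳ_) vs)
    startsWith-reindex g (σ₀≡v , σ₁≡w) = trans (lookup-reindex (dihedral g ⟨$⟩ʳ_) vs zero) σ₀≡v ,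
                                         trans (lookup-reindex (dihedral g ⟨$⟩ʳ_) vs (next zero)) σ₁≡w

  edgeAt-unreindex : ∀ us w g → StartsWith w us → EdgeAt (reindex (dihedral g ⟨$⟩ˡ_) us) g w
  edgeAt-unreindex us w g (u₀≡v , u₁≡w) = trans (undo zero) u₀≡v , trans (undo (next zero)) u₁≡w
    where
    undo : ∀ j → lookup (reindex (dihedral g ⟨$⟩ˡ_) us) (dihedral g ⟨$⟩ʳ j) ≡ lookup us j
    undo j = trans (lookup-reindex (dihedral g ⟨$⟩ˡ_) us _) (cong (lookup us) (inverseˡ (dihedral g)))

  through↔rooted×Symmetry : ∀ w → ⟨ through? w ⟩ ↔ (⟨ rooted? w ⟩ × Symmetry)
  through↔rooted×Symmetry w = mk↔ₛ′ root unroot root∘unroot unroot∘root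
    where
    root : ⟨ through? w ⟩ → ⟨ rooted? w ⟩ × Symmetry
    root (vs , t) = (reindex (dihedral g ⟨$⟩ʳ_) vs , fromWitness (cycle , startsWith)) , g
      where
      g = orientation vs w (proj₂ (toWitness t))
      cycle = IsCycle-reindex G (proj₁ g) (dihedral g) (dihedral-next g) vs (proj₁ (toWitness t))
      startsWith = startsWith-reindex vs w g (orientation-edgeAt vs w (proj₂ (toWitness t)))

    unroot : ⟨ rooted? w ⟩ × Symmetry → ⟨ through? w ⟩
    unroot ((us , t) , g) = vs , fromWitness (cycle , edgeAt⇒UsesEdge vs w g (edgeAt-unreindex us w g starts))
      where
      vs = reindex (dihedral g ⟨$⟩ˡ_) us
      starts = proj₂ (toWitness t)
      flip-symmetry = IsSymmetry-flip (proj₁ g) (dihedral g) (dihedral-next g)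
      cycle = IsCycle-reindex G (proj₁ g) (flip (dihedral g)) flip-symmetry us (proj₁ (toWitness t))

    unroot∘root : ∀ x → unroot (root x) ≡ x
    unroot∘root (vs , t) = ⟨⟩-≡ (through? w)
      (reindex-cancel (dihedral g ⟨$⟩ˡ_) (dihedral g ⟨$⟩ʳ_) (λ _ → inverseʳ (dihedral g)) vs)
      where g = orientation vs w (proj₂ (toWitness t))

    root∘unroot : ∀ y → root (unroot y) ≡ y
    root∘unroot ((us , t) , g) = rerooted (orientation vs w used) (edgeAt-unique vs w cycle _ g
      (orientation-edgeAt vs w used) (edgeAt-unreindex us w g (proj₂ (toWitness t))))
      where
      vs = reindex (dihedral g ⟨$⟩ˡ_) us
      cycle = proj₁ (toWitness (proj₂ (unroot ((us , t) , g))))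
      used = proj₂ (toWitness (proj₂ (unroot ((us , t) , g))))
      rerooted : ∀ h → h ≡ g → {s : True (rooted? w (reindex (dihedral h ⟨$⟩ʳ_) vs))} →
                 ((reindex (dihedral h ⟨$⟩ʳ_) vs , s) , h) ≡ ((us , t) , g)
      rerooted h refl = cong (_, g) (⟨⟩-≡ (rooted? w)
        (reindex-cancel (dihedral g ⟨$⟩ʳ_) (dihedral g ⟨$⟩ˡ_) (λ _ → inverseˡ (dihedral g)) us))

  Σ-rooted↔cycleAt : Σ (Fin n) (λ w → ⟨ rooted? w ⟩) ↔ ⟨ cycleAt? ⟩
  Σ-rooted↔cycleAt = mk↔ₛ′ forget second (λ _ → ⟨⟩-≡ cycleAt? refl) second∘forget
    where
    forget : Σ (Fin n) (λ w → ⟨ rooted? w ⟩) → ⟨ cycleAt? ⟩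
    forget (w , us , t) with toWitness t
    ... | cycle , u₀≡v , _ = us , fromWitness (cycle , u₀≡v)

    second : ⟨ cycleAt? ⟩ → Σ (Fin n) (λ w → ⟨ rooted? w ⟩)
    second (us , t) with toWitness t
    ... | cycle , u₀≡v = lookup us (next zero) , us , fromWitness (cycle , u₀≡v , refl)

    second∘forget : ∀ x → second (forget x) ≡ x
    second∘forget (w , us , t) = same-second (proj₂ (proj₂ (toWitness t)))
      where
      same-second : ∀ {w′} {t′ : True (rooted? w′ us)} → w′ ≡ w →
                    _≡_ {A = Σ (Fin n) (λ w → ⟨ rooted? w ⟩)} (w′ , us , t′) (w , us , t)
      same-second refl = cong (w ,_) (⟨⟩-≡ (rooted? w) refl)

  -- The reflection pairs each cycle rooted at v with its reverse; exactly one of the two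
  -- visits the smaller of the two neighbours of v on the cycle first.
  cycleAt↔Bool×ordered : ⟨ cycleAt? ⟩ ↔ (Bool × ⟨ (λ us → cycleAt? us ×-dec ordered? us) ⟩)
  cycleAt↔Bool×ordered = ⟨⟩↔Bool×⟨∩⟩ cycleAt? ordered? mirror
    (reindex-cancel reflect reflect reflect-involutive)
    (λ us (cycle , u₀≡v) → IsCycle-reindex G false reflection reflect-next us cycle ,
                           trans (lookup-reindex reflect us zero) u₀≡v)
    ordered-or-mirrored
    (λ us u₁<u₋₁ mirrored →
      Finₚ.<-asym u₁<u₋₁ (subst₂ Fin._<_ (mirror-next us) (mirror-prev us) mirrored))
    where
    mirror : Vec (Fin n) (suc m) → Vec (Fin n) (suc m)
    mirror = reindex reflect
    mirror-next : ∀ us → lookup (mirror us) (next zero) ≡ lookup us (prev zero)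
    mirror-next us = trans (lookup-reindex reflect us (next zero)) (cong (lookup us) (reflect-next zero))
    mirror-prev : ∀ us → lookup (mirror us) (prev zero) ≡ lookup us (next zero)
    mirror-prev us = trans (lookup-reindex reflect us (prev zero)) (cong (lookup us) (reflect-prev zero))
    ordered-or-mirrored : ∀ us → IsCycle G (suc m) us × lookup us zero ≡ v →
                          lookup us (next zero) Fin.< lookup us (prev zero) ⊎
                          lookup (mirror us) (next zero) Fin.< lookup (mirror us) (prev zero)
    ordered-or-mirrored us ((_ , injective , _) , _)
      with Finₚ.<-cmp (lookup us (next zero)) (lookup us (prev zero))
    ... | tri< u₁<u₋₁ _ _ = inj₁ u₁<u₋₁
    ... | tri≈ _ u₁≡u₋₁ _ = ⊥-elim (next≢prev 3≤K zero (injective _ _ u₁≡u₋₁))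
    ... | tri> _ _ u₋₁<u₁ = inj₂ (subst₂ Fin._<_ (sym (mirror-next us)) (sym (mirror-prev us)) u₋₁<u₁)

  rootedCount : Fin n → ℕ
  rootedCount w = length (filter (rooted? w) (allVecs n (suc m)))

  orderedCount : ℕ
  orderedCount = length (filter (λ us → cycleAt? us ×-dec ordered? us) (allVecs n (suc m)))

  cycleSeqsThrough≡ : ∀ w → cycleSeqsThrough G (suc m) v w ≡ rootedCount w * (2 * suc m)
  cycleSeqsThrough≡ w = ↔⇒≡ (begin
    Fin (cycleSeqsThrough G (suc m) v w)          ↔⟨ Fin-length-filter-allVecs↔⟨⟩ (suc m) (through? w) ⟩
    ⟨ through? w ⟩                                ↔⟨ through↔rooted×Symmetry w ⟩
    (⟨ rooted? w ⟩ × Bool × Fin (suc m))          ↔⟨ count ×-↔ (Finₚ.2↔Bool ×-↔ ↔-refl) ⟨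
    (Fin (rootedCount w) × Fin 2 × Fin (suc m))   ↔⟨ ↔-refl ×-↔ Finₚ.*↔× ⟨
    (Fin (rootedCount w) × Fin (2 * suc m))       ↔⟨ Finₚ.*↔× ⟨
    Fin (rootedCount w * (2 * suc m))             ∎)
    where
    open EquationalReasoning
    count = Fin-length-filter-allVecs↔⟨⟩ (suc m) (rooted? w)

  cyclesThrough≡rootedCount : ∀ w → cyclesThrough G (suc m) v w ≡ rootedCount w
  cyclesThrough≡rootedCount w =
    trans (cong (_/ (2 * suc m)) (cycleSeqsThrough≡ w)) (m*n/n≡m (rootedCount w) (2 * suc m))

  sum-rootedCount : sum (map rootedCount (allFin n)) ≡ 2 * orderedCount
  sum-rootedCount = trans (cong sum (map-tabulate id rootedCount)) (↔⇒≡ (begin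
    Fin (sum (tabulate rootedCount))      ↔⟨ Fin-sum-tabulate↔Σ rootedCount ⟩
    Σ (Fin n) (Fin ∘ rootedCount)         ↔⟨ Σ-↔ ↔-refl (λ {w} → count-rooted w) ⟩
    Σ (Fin n) (λ w → ⟨ rooted? w ⟩)       ↔⟨ Σ-rooted↔cycleAt ⟩
    ⟨ cycleAt? ⟩                          ↔⟨ cycleAt↔Bool×ordered ⟩
    (Bool × ⟨ cycleAt∩ordered? ⟩)         ↔⟨ Finₚ.2↔Bool ×-↔ count-ordered ⟨
    (Fin 2 × Fin orderedCount)            ↔⟨ Finₚ.*↔× ⟨
    Fin (2 * orderedCount)                ∎))
    where
    open EquationalReasoning
    cycleAt∩ordered? = λ us → cycleAt? us ×-dec ordered? us
    count-rooted = λ w → Fin-length-filter-allVecs↔⟨⟩ (suc m) (rooted? w)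
    count-ordered = Fin-length-filter-allVecs↔⟨⟩ (suc m) cycleAt∩ordered?

  odd⇒adjacent : ∀ w → Odd (cyclesThrough G (suc m) v w) → Adj G v w
  odd⇒adjacent w odd = nonempty (Fin-length-filter-allVecs↔⟨⟩ (suc m) (rooted? w))
                                (subst Odd (cyclesThrough≡rootedCount w) odd)
    where
    nonempty : ∀ {k} → Fin k ↔ ⟨ rooted? w ⟩ → Odd k → Adj G v w
    nonempty {suc k} count _ with Inverse.to count zero
    ... | us , t with toWitness t
    ... | (_ , _ , adjacent) , u₀≡v , u₁≡w = subst₂ (Adj G) u₀≡v u₁≡w (adjacent zero)

oddNeighbours-even : ∀ {n} (G : Graph n) {k} → 3 ≤ k → (v : Fin n) → Even (oddNeighbours G k v)
oddNeighbours-even {n} G {suc m} 3≤K v = begin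
  oddNeighbours G (suc m) v % 2
    ≡⟨ cong (λ ws → length ws % 2) (filter-≐ _ _ odd≐adjacent∩odd (allFin n)) ⟨
  length (filter (odd? c) (allFin n)) % 2
    ≡⟨ length-filter-Odd≡sum-mod-2 c (allFin n) ⟩
  sum (map c (allFin n)) % 2
    ≡⟨ cong (λ xs → sum xs % 2) (map-cong cyclesThrough≡rootedCount (allFin n)) ⟩
  sum (map rootedCount (allFin n)) % 2
    ≡⟨ cong (_% 2) (trans sum-rootedCount (*-comm 2 orderedCount)) ⟩
  (orderedCount * 2) % 2
    ≡⟨ m*n%n≡0 orderedCount 2 ⟩
  0 ∎
  where
  open RootedCycles G 3≤K v
  open ≡-Reasoning
  c = cyclesThrough G (suc m) v
  odd≐adjacent∩odd : (λ w → Odd (c w)) ≐ (λ w → Adj G v w × Odd (c w))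
  odd≐adjacent∩odd = (λ {w} odd → odd⇒adjacent w odd , odd) , proj₂

-- Of the odd-girth hypothesis only the existence of an ℓ-cycle, i.e. ℓ ≥ 3, is needed.
lemma5p11 : ∀ {n} (H : Graph n) (ℓ : ℕ) → OddGirth H ℓ → (v : Fin n) → Even (oddNeighbours H ℓ v)
lemma5p11 H ℓ (_ , (_ , 3≤ℓ , _) , _) = oddNeighbours-even H 3≤ℓ
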